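{- Run Algorithm PMR (defined in the context) with parameters $\gamma\ge1$, $0<R^*<1/2$, let $n\ell=|V_R|$ be the number of peeled-off vertices and let $T$ be any output tree. Then $ALG_P\ge(1-\ell/2)\,nW_R$.
   Context: Instance: a finite set $V$ of $n$ vertices of $G=(V,E)$ with nonnegative dissimilarity weights $w_{i,j}=w_{j,i}$; $W=\sum_{(i,j)\in E}w_{i,j}$. A hierarchical clustering tree $T$ is a rooted tree with leaf set $V$; $T_{i,j}$ is the subtree rooted at the least common ancestor of $i,j$, $|T_{i,j}|$ its number of leaves. Algorithm PMR: set $V_B\leftarrow V$, $E_B\leftarrow E$. While some $v\in V_B$ has $W_v=\sum_{u\in V_B,(v,u)\in E_B}w_{v,u}\ge\gamma\frac{2W}{n}$ (original $W,n$), choose $v^*$ with the largest $W_v$, split the current cluster $V_B$ into children $\{v^*\}$ and $V_B\setminus\{v^*\}$, delete $v^*$ from $V_B$ and its incident edges from $E_B$ (peel-off phase). The deleted vertices form $V_R$; red edges are edges with an endpoint in $V_R$, of total weight $W_R$; $R=W_R/W$. Then if $R>R^*$ the algorithm runs random partitioning on $V_B$, otherwise it splits $V_B$ by a Goemans–Williamson approximate max cut of $(V_B,E_B)$ and then runs random partitioning on each side. $ALG_P=\sum_{\text{red edges }(i,j)}w_{i,j}|T_{i,j}|$ is the contribution of the red edges to $Rev(T)=\sum_{i,j}w_{i,j}|T_{i,j}|$.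
   Formalization: The dissimilarity weights $w_{i,j}$ and the parameters γ and R* take rational values. -}

module Defs where

open import Data.Nat as ℕ using (ℕ; zero; suc)
open import Data.Integer using (+_)
open import Data.Rational using (ℚ; 0ℚ; 1ℚ; _+_; _*_; _-_; _≤_; _<_; _/_)
open import Data.Fin using (Fin; _<?_)
open import Data.Fin.Properties using (_≟_)
open import Data.Fin.Subset using (Subset; _∈_; ⊤; outside)
open import Data.Fin.Subset.Properties using (_∈?_)
open import Data.Vec using (_[_]≔_)
open import Data.List using (List; []; _∷_)
open import Data.Bool.ListAction using (any)
open import Data.Bool using (Bool; true; false; if_then_else_; _∧_; _∨_)
open import Data.Maybe using (Maybe; just; nothing)
open import Data.List.Relation.Unary.Unique.Propositional using (Unique)
open import Data.List.Membership.Propositional renaming (_∈_ to _∈ₗ_)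
open import Relation.Nullary using (does)
open import Relation.Binary.PropositionalEquality using (_≡_)
open import Data.Product using (_×_)

Σ : ∀ {n} → (Fin n → ℚ) → ℚ
Σ {zero}  f = 0ℚ
Σ {suc n} f = f Data.Fin.zero + Σ {n} (λ i → f (Data.Fin.suc i))

-- sum over unordered pairs {i , j}, encoded as i < j
Σpairs : ∀ {n} → (Fin n → Fin n → ℚ) → ℚ
Σpairs f = Σ (λ i → Σ (λ j → if does (i <? j) then f i j else 0ℚ))

ℕ→ℚ : ℕ → ℚ
ℕ→ℚ k = + k / 1

-- Weighted graph on V = Fin n.  The edge set E is encoded by the weight
-- function: non-edges have weight 0 (this affects none of the quantities).

record WGraph (n : ℕ) : Set where
  field
    w       : Fin n → Fin n → ℚ
    w-sym   : ∀ i j → w i j ≡ w j i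
    w-nonneg : ∀ i j → 0ℚ ≤ w i j
    w-loop  : ∀ i → w i i ≡ 0ℚ
  totalW : ℚ
  totalW = Σpairs w
  degIn : Subset n → Fin n → ℚ
  degIn B v = Σ (λ u → if does (u ∈? B) then w v u else 0ℚ)

remove : ∀ {n} → Subset n → Fin n → Subset n
remove B v = B [ v ]≔ outside

-- Peel G thr B vs B' : starting from the cluster B, the peel-off phase
-- removes exactly the vertices vs (in this order; any maximiser may be
-- chosen in case of ties) and stops with the cluster B'.

data Peel {n} (G : WGraph n) (thr : ℚ) : Subset n → List (Fin n) → Subset n → Set where
  stop : ∀ {B} →
         (∀ u → u ∈ B → WGraph.degIn G B u < thr) →
         Peel G thr B [] B
  step : ∀ {B vs B'} v →
         v ∈ B →
         thr ≤ WGraph.degIn G B v →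
         (∀ u → u ∈ B → WGraph.degIn G B u ≤ WGraph.degIn G B v) →
         Peel G thr (remove B v) vs B' →
         Peel G thr B (v ∷ vs) B'

data Tree (n : ℕ) : Set where
  leaf : Fin n → Tree n
  node : Tree n → Tree n → Tree n

leaves : ∀ {n} → Tree n → List (Fin n)
leaves (leaf x)   = x ∷ []
leaves (node l r) = Data.List._++_ (leaves l) (leaves r)

IsHC : ∀ {n} → Tree n → Set
IsHC {n} T = Unique (leaves T) × (∀ (i : Fin n) → i ∈ₗ leaves T)

nLeaves : ∀ {n} → Tree n → ℕ
nLeaves (leaf _)   = 1
nLeaves (node l r) = nLeaves l ℕ.+ nLeaves r

occurs : ∀ {n} → Fin n → Tree n → Bool
occurs i t = any (λ x → does (x ≟ i)) (leaves t)

lcaSize : ∀ {n} → Tree n → Fin n → Fin n → ℕ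
lcaSize (leaf _) i j = 1
lcaSize (node l r) i j =
  if occurs i l ∧ occurs j l then lcaSize l i j
  else if occurs i r ∧ occurs j r then lcaSize r i j
  else nLeaves (node l r)

-- The shape of a PMR output tree: peeling v₁,…,v_k creates the caterpillar
-- node (leaf v₁) (node (leaf v₂) … T_B), where T_B (if V_B ≠ ∅) is the tree
-- built on V_B by the second phase.
caterpillar : ∀ {n} → List (Fin n) → Maybe (Tree n) → Maybe (Tree n)
caterpillar []       m = m
caterpillar (v ∷ vs) m with caterpillar vs m
... | nothing = just (leaf v)
... | just t  = just (node (leaf v) t)

inList : ∀ {n} → Fin n → List (Fin n) → Bool
inList i vs = any (λ x → does (x ≟ i)) vs

-- weight of red edges (edges with an endpoint in V_R = vs)
W-R : ∀ {n} → WGraph n → List (Fin n) → ℚ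
W-R G vs = Σpairs (λ i j → if inList i vs ∨ inList j vs then WGraph.w G i j else 0ℚ)

ALG-P : ∀ {n} → WGraph n → List (Fin n) → Tree n → ℚ
ALG-P G vs T = Σpairs (λ i j → if inList i vs ∨ inList j vs
                                 then WGraph.w G i j * ℕ→ℚ (lcaSize T i j) else 0ℚ)

module Submission where

-- Let v₁, …, v_k be the peeled vertices, N ≥ n the number of leaves of T, and d_m the degree
-- of v_m inside the cluster from which it is peeled.  The red edges first met at v_m weigh d_m
-- in total and have their lca at the m-th spine node, which has N − m + 1 leaves.  Since v_m
-- is a heaviest vertex and degrees only drop when vertices are removed, d_m bounds every later
-- degree, so the red weight peeled after v_m is at most (k − m)·d_m.  An induction along the
-- peel then proves (N − k/2)·W_R ≤ ALG_P for each remaining cluster and its subtree; finally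
-- N ≥ n.

open import Defs
open import Data.Nat using (ℕ; NonZero)
open import Data.Integer using (+_)
open import Data.Rational using (ℚ; 0ℚ; 1ℚ; _+_; _*_; _-_; _≤_; _<_; _≥_; _/_)
open import Data.Fin using (Fin)
open import Data.Fin.Subset using (Subset; ⊤)
open import Data.List using (List; length)
open import Data.Maybe using (Maybe; just)
open import Relation.Binary.PropositionalEquality using (_≡_)

open import Algebra.Bundles using (CommutativeMonoid)
open import Data.Bool using (Bool; true; false; if_then_else_; _∧_; _∨_; not)
open import Data.Bool.Properties using (∧-comm; ∧-zeroʳ; ∨-zeroʳ)
open import Data.Empty using (⊥-elim)
open import Data.Fin as F using (_<?_)
open import Data.Fin.Properties using (_≟_; <-irrefl; <-asym; <-cmp; <⇒≢; injective⇒≤)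
open import Data.Fin.Subset using (_∈_; outside)
open import Data.Fin.Subset.Properties using (_∈?_; ∈⊤)
import Data.Integer as ℤ
import Data.Integer.Properties as ℤ
open import Data.Integer.Solver using () renaming (module +-*-Solver to ℤ-Solver)
open import Data.List using ([]; _∷_; lookup)
open import Data.List.Membership.Propositional using () renaming (_∈_ to _∈ₗ_)
open import Data.List.Properties using (length-++)
open import Data.List.Relation.Unary.All using (All; []; _∷_)
import Data.List.Relation.Unary.AllPairs as AllPairs
open import Data.List.Relation.Unary.Any using (here; there; index)
open import Data.List.Relation.Unary.Any.Properties using (lookup-index)
open import Data.List.Relation.Unary.Unique.Propositional using (Unique)
open import Data.Maybe using (nothing)
open import Data.Maybe.Properties using (just-injective)
import Data.Nat as ℕ
open import Data.Product using (_×_; _,_; proj₁; proj₂; ∃-syntax)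
open import Data.Rational using (½; -_; toℚᵘ; nonNegative)
import Data.Rational.Properties as ℚ
open import Data.Rational.Solver using (module +-*-Solver)
open import Data.Rational.Unnormalised as ℚᵘ using (mkℚᵘ; *≡*; *≤*)
import Data.Rational.Unnormalised.Properties as ℚᵘ
open import Data.Sum using (_⊎_; inj₁; inj₂)
open import Data.Vec.Properties
  using ([]=-injective; []≔-updates; []≔-minimal; lookup⇒[]=; []=⇒lookup; lookup∘update′)
open import Function using (_∘_; _∘₂_)
open import Function.Bundles using (mk⇔)
open import Relation.Binary.Definitions using (tri<; tri≈; tri>)
open import Relation.Binary.PropositionalEquality
  using (_≢_; refl; sym; trans; cong; cong₂; subst; module ≡-Reasoning)
open import Relation.Nullary using (Dec; yes; no; does)
open import Relation.Nullary.Decidable using (dec-true; dec-false; does-⇔)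

open import Algebra.Properties.CommutativeSemigroup
  (CommutativeMonoid.commutativeSemigroup ℚ.+-0-commutativeMonoid) using (interchange)

infixr 8 [_]·_

[_]·_ : Bool → ℚ → ℚ
[ b ]· x = if b then x else 0ℚ

[]·-zero : ∀ b → [ b ]· 0ℚ ≡ 0ℚ
[]·-zero true  = refl
[]·-zero false = refl

[]·-comm : ∀ a b x → [ a ]· [ b ]· x ≡ [ b ]· [ a ]· x
[]·-comm true  b     x = refl
[]·-comm false true  x = refl
[]·-comm false false x = refl

[]·-distrib-+ : ∀ b x y → [ b ]· (x + y) ≡ [ b ]· x + [ b ]· y
[]·-distrib-+ true  x y = refl
[]·-distrib-+ false x y = refl

[]·-*ˡ : ∀ b c x → [ b ]· (c * x) ≡ c * [ b ]· x
[]·-*ˡ true  c x = refl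
[]·-*ˡ false c x = sym (ℚ.*-zeroʳ c)

[]·-nonneg : ∀ b {x} → 0ℚ ≤ x → 0ℚ ≤ [ b ]· x
[]·-nonneg true  0≤x = 0≤x
[]·-nonneg false _   = ℚ.≤-refl

-- Goals mention does (i <? j) only in reduced form (toℕ i <ᵇ toℕ j), so `with i <? j` cannot
-- abstract it; case splits therefore go through Dec arguments, as here.
[]·-cong : ∀ {P : Set} (P? : Dec P) {x y} → (P → x ≡ y) → [ does P? ]· x ≡ [ does P? ]· y
[]·-cong (yes p) x≡y = x≡y p
[]·-cong (no _)  _   = refl

Σ-cong : ∀ {n} {f g : Fin n → ℚ} → (∀ i → f i ≡ g i) → Σ f ≡ Σ g
Σ-cong {ℕ.zero}  f≗g = refl
Σ-cong {ℕ.suc n} f≗g = cong₂ _+_ (f≗g F.zero) (Σ-cong (f≗g ∘ F.suc))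

Σ-zero : ∀ n → Σ {n} (λ _ → 0ℚ) ≡ 0ℚ
Σ-zero ℕ.zero    = refl
Σ-zero (ℕ.suc n) = trans (ℚ.+-identityˡ _) (Σ-zero n)

Σ-distrib-+ : ∀ {n} (f g : Fin n → ℚ) → Σ (λ i → f i + g i) ≡ Σ f + Σ g
Σ-distrib-+ {ℕ.zero}  f g = refl
Σ-distrib-+ {ℕ.suc n} f g =
  trans (cong (_+_ (f F.zero + g F.zero)) (Σ-distrib-+ (f ∘ F.suc) (g ∘ F.suc)))
        (interchange (f F.zero) (g F.zero) (Σ (f ∘ F.suc)) (Σ (g ∘ F.suc)))

Σ-*ˡ : ∀ {n} c (f : Fin n → ℚ) → Σ (λ i → c * f i) ≡ c * Σ f
Σ-*ˡ {ℕ.zero}  c f = sym (ℚ.*-zeroʳ c)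
Σ-*ˡ {ℕ.suc n} c f =
  trans (cong (_+_ (c * f F.zero)) (Σ-*ˡ c (f ∘ F.suc)))
        (sym (ℚ.*-distribˡ-+ c (f F.zero) (Σ (f ∘ F.suc))))

Σ-mono-≤ : ∀ {n} {f g : Fin n → ℚ} → (∀ i → f i ≤ g i) → Σ f ≤ Σ g
Σ-mono-≤ {ℕ.zero}  f≤g = ℚ.≤-refl
Σ-mono-≤ {ℕ.suc n} f≤g = ℚ.+-mono-≤ (f≤g F.zero) (Σ-mono-≤ (f≤g ∘ F.suc))

Σ-nonneg : ∀ {n} {f : Fin n → ℚ} → (∀ i → 0ℚ ≤ f i) → 0ℚ ≤ Σ f
Σ-nonneg {n} 0≤f = ℚ.≤-trans (ℚ.≤-reflexive (sym (Σ-zero n))) (Σ-mono-≤ 0≤f)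

Σ-[]· : ∀ {n} b (f : Fin n → ℚ) → Σ (λ i → [ b ]· f i) ≡ [ b ]· Σ f
Σ-[]· {n} true  f = refl
Σ-[]· {n} false f = Σ-zero n

Σ-δ : ∀ {n} (v : Fin n) (f : Fin n → ℚ) → Σ (λ i → [ does (v ≟ i) ]· f i) ≡ f v
Σ-δ {ℕ.suc n} F.zero    f = trans (cong (_+_ (f F.zero)) (Σ-zero n)) (ℚ.+-identityʳ _)
Σ-δ {ℕ.suc n} (F.suc v) f = trans (ℚ.+-identityˡ _) (Σ-δ v (f ∘ F.suc))

Σpairs-cong : ∀ {n} {f g : Fin n → Fin n → ℚ} → (∀ i j → i F.< j → f i j ≡ g i j) →
              Σpairs f ≡ Σpairs g
Σpairs-cong f≗g = Σ-cong λ i → Σ-cong λ j → []·-cong (i <? j) (f≗g i j)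

Σpairs-zero : ∀ n → Σpairs {n} (λ _ _ → 0ℚ) ≡ 0ℚ
Σpairs-zero n = trans
  (Σ-cong {n} λ i → trans (Σ-cong {n} λ j → []·-zero (does (i <? j))) (Σ-zero n))
  (Σ-zero n)

Σpairs-distrib-+ : ∀ {n} (f g : Fin n → Fin n → ℚ) →
                   Σpairs (λ i j → f i j + g i j) ≡ Σpairs f + Σpairs g
Σpairs-distrib-+ {n} f g = trans
  (Σ-cong λ i → trans (Σ-cong λ j → []·-distrib-+ (does (i <? j)) (f i j) (g i j)) (Σ-distrib-+ {n} _ _))
  (Σ-distrib-+ {n} _ _)

Σpairs-*ˡ : ∀ {n} c (f : Fin n → Fin n → ℚ) → Σpairs (λ i j → c * f i j) ≡ c * Σpairs f
Σpairs-*ˡ {n} c f = trans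
  (Σ-cong λ i → trans (Σ-cong λ j → []·-*ˡ (does (i <? j)) c (f i j)) (Σ-*ˡ {n} c _))
  (Σ-*ˡ {n} c _)

Σpairs-nonneg : ∀ {n} {f : Fin n → Fin n → ℚ} → (∀ i j → 0ℚ ≤ f i j) → 0ℚ ≤ Σpairs f
Σpairs-nonneg 0≤f = Σ-nonneg λ i → Σ-nonneg λ j → []·-nonneg (does (i <? j)) (0≤f i j)

redSum : ∀ {n} → List (Fin n) → (Fin n → Fin n → ℚ) → ℚ
redSum vs f = Σpairs (λ i j → [ inList i vs ∨ inList j vs ]· f i j)

module _ {n} (v : Fin n) where
  open ≡-Reasoning

  Σpairs-δˡ : (g : Fin n → ℚ) →
              Σpairs (λ i j → [ does (v ≟ i) ]· g j) ≡ Σ (λ j → [ does (v <? j) ]· g j)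
  Σpairs-δˡ g = begin
    Σ (λ i → Σ (λ j → [ does (i <? j) ]· [ does (v ≟ i) ]· g j))
      ≡⟨ Σ-cong (λ i → Σ-cong λ j → []·-comm (does (i <? j)) (does (v ≟ i)) (g j)) ⟩
    Σ (λ i → Σ (λ j → [ does (v ≟ i) ]· [ does (i <? j) ]· g j))
      ≡⟨ Σ-cong (λ i → Σ-[]· {n} (does (v ≟ i)) _) ⟩
    Σ (λ i → [ does (v ≟ i) ]· Σ (λ j → [ does (i <? j) ]· g j))
      ≡⟨ Σ-δ v _ ⟩
    Σ (λ j → [ does (v <? j) ]· g j) ∎

  Σpairs-δʳ : (g : Fin n → ℚ) →
              Σpairs (λ i j → [ does (v ≟ j) ]· g i) ≡ Σ (λ i → [ does (i <? v) ]· g i)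
  Σpairs-δʳ g = Σ-cong λ i → begin
    Σ (λ j → [ does (i <? j) ]· [ does (v ≟ j) ]· g i)
      ≡⟨ Σ-cong (λ j → []·-comm (does (i <? j)) (does (v ≟ j)) (g i)) ⟩
    Σ (λ j → [ does (v ≟ j) ]· [ does (i <? j) ]· g i)
      ≡⟨ Σ-δ v _ ⟩
    [ does (i <? v) ]· g i ∎

  Σ-split-at : (g : Fin n → ℚ) → g v ≡ 0ℚ →
               Σ (λ u → [ does (v <? u) ]· g u) + Σ (λ u → [ does (u <? v) ]· g u) ≡ Σ g
  Σ-split-at g gv≡0 = trans (sym (Σ-distrib-+ {n} _ _)) (Σ-cong λ u → split u (v <? u) (u <? v))
    where
    split : ∀ u (v<u? : Dec (v F.< u)) (u<v? : Dec (u F.< v)) →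
            [ does v<u? ]· g u + [ does u<v? ]· g u ≡ g u
    split u (yes v<u) (yes u<v) = ⊥-elim (<-asym v<u u<v)
    split u (yes _)   (no _)    = ℚ.+-identityʳ (g u)
    split u (no _)    (yes _)   = ℚ.+-identityˡ (g u)
    split u (no v≮u)  (no u≮v) with <-cmp v u
    ... | tri< v<u _    _   = ⊥-elim (v≮u v<u)
    ... | tri≈ _   refl _   = sym gv≡0
    ... | tri> _   _    u<v = ⊥-elim (u≮v u<v)

  redSum-singleton : (f : Fin n → Fin n → ℚ) → (∀ i j → f i j ≡ f j i) → f v v ≡ 0ℚ →
                     redSum (v ∷ []) f ≡ Σ (f v)
  redSum-singleton f f-sym fvv≡0 = begin
    redSum (v ∷ []) f
      ≡⟨ Σpairs-cong (λ i j i<j → by-endpoint i j i<j (v ≟ i) (v ≟ j)) ⟩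
    Σpairs (λ i j → [ does (v ≟ i) ]· f v j + [ does (v ≟ j) ]· f v i)
      ≡⟨ Σpairs-distrib-+ {n} _ _ ⟩
    Σpairs (λ i j → [ does (v ≟ i) ]· f v j) + Σpairs (λ i j → [ does (v ≟ j) ]· f v i)
      ≡⟨ cong₂ _+_ (Σpairs-δˡ (f v)) (Σpairs-δʳ (f v)) ⟩
    Σ (λ u → [ does (v <? u) ]· f v u) + Σ (λ u → [ does (u <? v) ]· f v u)
      ≡⟨ Σ-split-at (f v) fvv≡0 ⟩
    Σ (f v) ∎
    where
    by-endpoint : ∀ i j → i F.< j → (v≟i : Dec (v ≡ i)) (v≟j : Dec (v ≡ j)) →
                  [ (does v≟i ∨ false) ∨ (does v≟j ∨ false) ]· f i j
                  ≡ [ does v≟i ]· f v j + [ does v≟j ]· f v i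
    by-endpoint i j i<j (yes refl) (yes refl) = ⊥-elim (<-irrefl refl i<j)
    by-endpoint i j _   (yes refl) (no _)     = sym (ℚ.+-identityʳ _)
    by-endpoint i j _   (no _)     (yes refl) = trans (f-sym i v) (sym (ℚ.+-identityˡ _))
    by-endpoint i j _   (no _)     (no _)     = refl

redSum-[] : ∀ {n} (f : Fin n → Fin n → ℚ) → redSum [] f ≡ 0ℚ
redSum-[] {n} f = Σpairs-zero n

redSum-cong : ∀ {n} vs {f g : Fin n → Fin n → ℚ} → (∀ i j → f i j ≡ g i j) →
              redSum vs f ≡ redSum vs g
redSum-cong vs f≗g = Σpairs-cong λ i j _ → cong [ inList i vs ∨ inList j vs ]·_ (f≗g i j)

redSum-*ˡ : ∀ {n} vs c (f : Fin n → Fin n → ℚ) → redSum vs (λ i j → c * f i j) ≡ c * redSum vs f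
redSum-*ˡ {n} vs c f = trans
  (Σpairs-cong λ i j _ → []·-*ˡ (inList i vs ∨ inList j vs) c (f i j))
  (Σpairs-*ˡ {n} c _)

redSum-nonneg : ∀ {n} vs {f : Fin n → Fin n → ℚ} → (∀ i j → 0ℚ ≤ f i j) → 0ℚ ≤ redSum vs f
redSum-nonneg vs 0≤f = Σpairs-nonneg λ i j → []·-nonneg (inList i vs ∨ inList j vs) (0≤f i j)

_∈ᵇ_ : ∀ {n} → Fin n → Subset n → Bool
i ∈ᵇ B = does (i ∈? B)

∈-remove⁻ : ∀ {n} {B : Subset n} {v u} → u ∈ remove B v → v ≢ u × u ∈ B
∈-remove⁻ {B = B} {v} {u} u∈B-v with v ≟ u
... | yes refl with () ← []=-injective ([]≔-updates B v) u∈B-v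
... | no v≢u = v≢u , lookup⇒[]= u B
  (trans (sym (lookup∘update′ (v≢u ∘ sym) B outside)) ([]=⇒lookup u∈B-v))

∈-remove⁺ : ∀ {n} {B : Subset n} {v u} → v ≢ u → u ∈ B → u ∈ remove B v
∈-remove⁺ {B = B} {v} {u} v≢u u∈B = []≔-minimal B u v (v≢u ∘ sym) u∈B

∈ᵇ-remove : ∀ {n} (B : Subset n) v i → i ∈ᵇ remove B v ≡ not (does (v ≟ i)) ∧ i ∈ᵇ B
∈ᵇ-remove B v i with v ≟ i
... | yes refl = dec-false (i ∈? remove B i) λ i∈B-i → proj₁ (∈-remove⁻ i∈B-i) refl
... | no v≢i   = does-⇔ (mk⇔ (proj₂ ∘ ∈-remove⁻) (∈-remove⁺ v≢i)) (i ∈? remove B v) (i ∈? B)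

restrict : ∀ {n} → Subset n → (Fin n → Fin n → ℚ) → Fin n → Fin n → ℚ
restrict B f i j = [ i ∈ᵇ B ∧ j ∈ᵇ B ]· f i j

restrict-cong : ∀ {n} (B : Subset n) {f g : Fin n → Fin n → ℚ} →
                (∀ {i j} → i ∈ B → j ∈ B → f i j ≡ g i j) →
                ∀ i j → restrict B f i j ≡ restrict B g i j
restrict-cong B f≗g i j with i ∈? B | j ∈? B
... | yes i∈B | yes j∈B = f≗g i∈B j∈B
... | yes _   | no  _   = refl
... | no  _   | _       = refl

restrict-⊤ : ∀ {n} (f : Fin n → Fin n → ℚ) i j → restrict ⊤ f i j ≡ f i j
restrict-⊤ f i j rewrite dec-true (i ∈? ⊤) ∈⊤ | dec-true (j ∈? ⊤) ∈⊤ = refl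

restrict-sym : ∀ {n} (B : Subset n) {f : Fin n → Fin n → ℚ} →
               (∀ i j → f i j ≡ f j i) → ∀ i j → restrict B f i j ≡ restrict B f j i
restrict-sym B f-sym i j = cong₂ [_]·_ (∧-comm (i ∈ᵇ B) (j ∈ᵇ B)) (f-sym i j)

restrict-diag : ∀ {n} (B : Subset n) {f : Fin n → Fin n → ℚ} v → f v v ≡ 0ℚ → restrict B f v v ≡ 0ℚ
restrict-diag B v fvv≡0 = trans (cong [ v ∈ᵇ B ∧ v ∈ᵇ B ]·_ fvv≡0) ([]·-zero (v ∈ᵇ B ∧ v ∈ᵇ B))

redSum-∷ : ∀ {n} (B : Subset n) v vs f →
           redSum (v ∷ vs) (restrict B f)
           ≡ redSum (v ∷ []) (restrict B f) + redSum vs (restrict (remove B v) f)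
redSum-∷ {n} B v vs f = trans (Σpairs-cong λ i j _ → split-red i j) (Σpairs-distrib-+ {n} _ _)
  where
  split-red : ∀ i j → [ inList i (v ∷ vs) ∨ inList j (v ∷ vs) ]· restrict B f i j
                      ≡ [ inList i (v ∷ []) ∨ inList j (v ∷ []) ]· restrict B f i j
                        + [ inList i vs ∨ inList j vs ]· restrict (remove B v) f i j
  split-red i j rewrite ∈ᵇ-remove B v i | ∈ᵇ-remove B v j =
    split (does (v ≟ i)) (does (v ≟ j)) (i ∈ᵇ B) (j ∈ᵇ B) (inList i vs) (inList j vs) (f i j)
    where
    split : ∀ eᵢ eⱼ bᵢ bⱼ lᵢ lⱼ x →
            [ (eᵢ ∨ lᵢ) ∨ (eⱼ ∨ lⱼ) ]· [ bᵢ ∧ bⱼ ]· x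
            ≡ [ (eᵢ ∨ false) ∨ (eⱼ ∨ false) ]· [ bᵢ ∧ bⱼ ]· x
              + [ lᵢ ∨ lⱼ ]· [ (not eᵢ ∧ bᵢ) ∧ (not eⱼ ∧ bⱼ) ]· x
    split true  _    bᵢ bⱼ lᵢ lⱼ x =
      sym (trans (cong (_+_ ([ bᵢ ∧ bⱼ ]· x)) ([]·-zero (lᵢ ∨ lⱼ))) (ℚ.+-identityʳ _))
    split false true bᵢ bⱼ lᵢ lⱼ x rewrite ∨-zeroʳ lᵢ | ∧-zeroʳ bᵢ =
      sym (trans (cong (_+_ ([ bᵢ ∧ bⱼ ]· x)) ([]·-zero (lᵢ ∨ lⱼ))) (ℚ.+-identityʳ _))
    split false false _ _ _ _ _ = sym (ℚ.+-identityˡ _)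

inList-∈ : ∀ {n} {i : Fin n} {xs} → i ∈ₗ xs → inList i xs ≡ true
inList-∈ {i = i} {_ ∷ xs} (here refl) = cong (_∨ inList i xs) (dec-true (i ≟ i) refl)
inList-∈ {i = i} {x ∷ _} (there i∈xs) = trans (cong (does (x ≟ i) ∨_) (inList-∈ i∈xs)) (∨-zeroʳ _)

inList-∉ : ∀ {n} {i : Fin n} {xs} → All (i ≢_) xs → inList i xs ≡ false
inList-∉ []                         = refl
inList-∉ {i = i} {x ∷ _} (i≢x ∷ i∉xs) = cong₂ _∨_ (dec-false (x ≟ i) (i≢x ∘ sym)) (inList-∉ i∉xs)

lcaSize-node-root : ∀ {n} (l r : Tree n) {i j} →
                    occurs i l ∧ occurs j l ≡ false → occurs i r ∧ occurs j r ≡ false →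
                    lcaSize (node l r) i j ≡ nLeaves (node l r)
lcaSize-node-root l r ¬both-l ¬both-r rewrite ¬both-l | ¬both-r = refl

lcaSize-node-right : ∀ {n} (l r : Tree n) {i j} →
                     occurs i l ∧ occurs j l ≡ false → occurs i r ∧ occurs j r ≡ true →
                     lcaSize (node l r) i j ≡ lcaSize r i j
lcaSize-node-right l r ¬both-l both-r rewrite ¬both-l | both-r = refl

LcaAtRoot : ∀ {n} → Tree n → Fin n → Set
LcaAtRoot T v = ∀ i j → i ≢ j → v ≡ i ⊎ v ≡ j → lcaSize T i j ≡ nLeaves T

lcaAtRoot-spine : ∀ {n} (v : Fin n) T → All (v ≢_) (leaves T) → LcaAtRoot (node (leaf v) T) v
lcaAtRoot-spine v T v∉T i j i≢j v∈ij =
  lcaSize-node-root (leaf v) T (not-both-at-leaf (v ≟ i) (v ≟ j)) (not-both-below v∈ij)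
  where
  not-both-at-leaf : (v≟i : Dec (v ≡ i)) (v≟j : Dec (v ≡ j)) →
                     (does v≟i ∨ false) ∧ (does v≟j ∨ false) ≡ false
  not-both-at-leaf (yes refl) (yes refl) = ⊥-elim (i≢j refl)
  not-both-at-leaf (yes refl) (no _)     = refl
  not-both-at-leaf (no _)     _          = refl
  not-both-below : v ≡ i ⊎ v ≡ j → occurs i T ∧ occurs j T ≡ false
  not-both-below (inj₁ refl) = cong (_∧ occurs j T) (inList-∉ v∉T)
  not-both-below (inj₂ refl) = trans (cong (occurs i T ∧_) (inList-∉ v∉T)) (∧-zeroʳ _)

lcaSize-spine-below : ∀ {n} (v : Fin n) T {i j} → v ≢ i → i ∈ₗ leaves T → j ∈ₗ leaves T →
                      lcaSize (node (leaf v) T) i j ≡ lcaSize T i j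
lcaSize-spine-below v T {i} {j} v≢i i∈T j∈T = lcaSize-node-right (leaf v) T
  (cong (λ b → (b ∨ false) ∧ occurs j (leaf v)) (dec-false (v ≟ i) v≢i))
  (cong₂ _∧_ (inList-∈ i∈T) (inList-∈ j∈T))

nLeaves≡length : ∀ {n} (T : Tree n) → nLeaves T ≡ length (leaves T)
nLeaves≡length (leaf _)   = refl
nLeaves≡length (node l r) =
  trans (cong₂ ℕ._+_ (nLeaves≡length l) (nLeaves≡length r)) (sym (length-++ (leaves l)))

n≤nLeaves : ∀ {n} (T : Tree n) → (∀ i → i ∈ₗ leaves T) → n ℕ.≤ nLeaves T
n≤nLeaves T covers = subst (_ ℕ.≤_) (sym (nLeaves≡length T)) (injective⇒≤ position-injective)
  where
  position-injective : ∀ {i j} → index (covers i) ≡ index (covers j) → i ≡ j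
  position-injective eq =
    trans (lookup-index (covers _)) (trans (cong (lookup (leaves T)) eq) (sym (lookup-index (covers _))))

caterpillar-nothing : ∀ {n} (vs : List (Fin n)) TB → caterpillar vs TB ≡ nothing → vs ≡ []
caterpillar-nothing []       TB _  = refl
caterpillar-nothing (v ∷ vs) TB eq with caterpillar vs TB
caterpillar-nothing (v ∷ vs) TB () | nothing
caterpillar-nothing (v ∷ vs) TB () | just _

caterpillar-∷ : ∀ {n} (v : Fin n) vs TB {T} → caterpillar (v ∷ vs) TB ≡ just T →
                (vs ≡ [] × T ≡ leaf v) ⊎ (∃[ T′ ] caterpillar vs TB ≡ just T′ × T ≡ node (leaf v) T′)
caterpillar-∷ v vs TB eq with caterpillar vs TB in cat
... | nothing = inj₁ (caterpillar-nothing vs TB cat , sym (just-injective eq))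
... | just T′ = inj₂ (T′ , refl , sym (just-injective eq))

ℕ→ℚ-toℚᵘ : ∀ m → toℚᵘ (ℕ→ℚ m) ℚᵘ.≃ mkℚᵘ (+ m) 0
ℕ→ℚ-toℚᵘ m = ℚ.toℚᵘ-fromℚᵘ (mkℚᵘ (+ m) 0)

ℕ→ℚ-suc : ∀ m → ℕ→ℚ (ℕ.suc m) ≡ 1ℚ + ℕ→ℚ m
ℕ→ℚ-suc m = ℚ.toℚᵘ-injective (begin-equality
  toℚᵘ (ℕ→ℚ (ℕ.suc m))
    ≃⟨ ℕ→ℚ-toℚᵘ (ℕ.suc m) ⟩
  mkℚᵘ (+ ℕ.suc m) 0
    ≃⟨ *≡* (solve 1 (λ m → (con (+ 1) :+ m) :* (con (+ 1) :* con (+ 1))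
                          := (con (+ 1) :* con (+ 1) :+ m :* con (+ 1)) :* con (+ 1)) refl (+ m)) ⟩
  toℚᵘ 1ℚ ℚᵘ.+ mkℚᵘ (+ m) 0
    ≃⟨ ℚᵘ.+-congʳ (toℚᵘ 1ℚ) (ℚᵘ.≃-sym (ℕ→ℚ-toℚᵘ m)) ⟩
  toℚᵘ 1ℚ ℚᵘ.+ toℚᵘ (ℕ→ℚ m)
    ≃⟨ ℚᵘ.≃-sym (ℚ.toℚᵘ-homo-+ 1ℚ (ℕ→ℚ m)) ⟩
  toℚᵘ (1ℚ + ℕ→ℚ m) ∎)
  where open ℚᵘ.≤-Reasoning; open ℤ-Solver

k/n*n≡k : ∀ k n → (+ k / ℕ.suc n) * ℕ→ℚ (ℕ.suc n) ≡ ℕ→ℚ k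
k/n*n≡k k n = ℚ.toℚᵘ-injective (begin-equality
  toℚᵘ ((+ k / ℕ.suc n) * ℕ→ℚ (ℕ.suc n))
    ≃⟨ ℚ.toℚᵘ-homo-* (+ k / ℕ.suc n) (ℕ→ℚ (ℕ.suc n)) ⟩
  toℚᵘ (+ k / ℕ.suc n) ℚᵘ.* toℚᵘ (ℕ→ℚ (ℕ.suc n))
    ≃⟨ ℚᵘ.*-cong (ℚ.toℚᵘ-fromℚᵘ (mkℚᵘ (+ k) n)) (ℕ→ℚ-toℚᵘ (ℕ.suc n)) ⟩
  mkℚᵘ (+ k) n ℚᵘ.* mkℚᵘ (+ ℕ.suc n) 0
    ≃⟨ *≡* (solve 2 (λ k n → (k :* n) :* con (+ 1) := k :* (n :* con (+ 1))) refl (+ k) (+ ℕ.suc n)) ⟩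
  mkℚᵘ (+ k) 0
    ≃⟨ ℚᵘ.≃-sym (ℕ→ℚ-toℚᵘ k) ⟩
  toℚᵘ (ℕ→ℚ k) ∎)
  where open ℚᵘ.≤-Reasoning; open ℤ-Solver

ℕ→ℚ-mono-≤ : ∀ {m n} → m ℕ.≤ n → ℕ→ℚ m ≤ ℕ→ℚ n
ℕ→ℚ-mono-≤ {m} {n} m≤n = ℚ.toℚᵘ-cancel-≤ (begin
  toℚᵘ (ℕ→ℚ m)     ≃⟨ ℕ→ℚ-toℚᵘ m ⟩
  mkℚᵘ (+ m) 0     ≤⟨ *≤* (ℤ.*-monoʳ-≤-nonNeg (+ 1) (ℤ.+≤+ m≤n)) ⟩
  mkℚᵘ (+ n) 0     ≃⟨ ℚᵘ.≃-sym (ℕ→ℚ-toℚᵘ n) ⟩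
  toℚᵘ (ℕ→ℚ n)     ∎)
  where open ℚᵘ.≤-Reasoning

ℕ→ℚ-suc-* : ∀ k D → ℕ→ℚ (ℕ.suc k) * D ≡ D + ℕ→ℚ k * D
ℕ→ℚ-suc-* k D = trans (cong (_* D) (ℕ→ℚ-suc k))
                  (trans (ℚ.*-distribʳ-+ D 1ℚ (ℕ→ℚ k)) (cong (_+ ℕ→ℚ k * D) (ℚ.*-identityˡ D)))

0≤q-p : ∀ {p q} → p ≤ q → 0ℚ ≤ q - p
0≤q-p {p} {q} p≤q = begin
  0ℚ         ≡⟨ sym (ℚ.+-inverseʳ p) ⟩
  p - p      ≤⟨ ℚ.+-monoˡ-≤ (- p) p≤q ⟩
  q - p      ∎
  where open ℚ.≤-Reasoning

p≤p+q : ∀ {p q} → 0ℚ ≤ q → p ≤ p + q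
p≤p+q {p} {q} 0≤q = begin
  p          ≡⟨ sym (ℚ.+-identityʳ p) ⟩
  p + 0ℚ     ≤⟨ ℚ.+-monoʳ-≤ p 0≤q ⟩
  p + q      ∎
  where open ℚ.≤-Reasoning

averaging-step : ∀ N K {a R A} → 0ℚ ≤ a → R ≤ K * a → (N - K * ½) * R ≤ A →
                 ((1ℚ + N) - (1ℚ + K) * ½) * (a + R) ≤ (1ℚ + N) * a + A
averaging-step N K {a} {R} {A} 0≤a R≤Ka NR≤A = begin
  ((1ℚ + N) - (1ℚ + K) * ½) * (a + R)                          ≤⟨ p≤p+q 0≤slack ⟩
  ((1ℚ + N) - (1ℚ + K) * ½) * (a + R) + ½ * ((K * a + a) - R)  ≡⟨ rearrange N K a R ⟩
  (1ℚ + N) * a + (N - K * ½) * R                               ≤⟨ ℚ.+-monoʳ-≤ ((1ℚ + N) * a) NR≤A ⟩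
  (1ℚ + N) * a + A                                             ∎
  where
  open ℚ.≤-Reasoning
  0≤slack : 0ℚ ≤ ½ * ((K * a + a) - R)
  0≤slack = ℚ.≤-trans (ℚ.≤-reflexive (sym (ℚ.*-zeroʳ ½)))
                      (ℚ.*-monoˡ-≤-nonNeg ½ (0≤q-p (ℚ.≤-trans R≤Ka (p≤p+q 0≤a))))
  rearrange : ∀ N K a R → ((1ℚ + N) - (1ℚ + K) * ½) * (a + R) + ½ * ((K * a + a) - R)
                        ≡ (1ℚ + N) * a + (N - K * ½) * R
  rearrange = solve 4 (λ N K a R →
    ((con 1ℚ :+ N) :- (con 1ℚ :+ K) :* con ½) :* (a :+ R) :+ con ½ :* ((K :* a :+ a) :- R)
    := (con 1ℚ :+ N) :* a :+ (N :- K :* con ½) :* R) refl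
    where open +-*-Solver

module Peeling {n} (G : WGraph n) (thr : ℚ) where
  open WGraph G

  revenue : Tree n → Fin n → Fin n → ℚ
  revenue T i j = w i j * ℕ→ℚ (lcaSize T i j)

  redWeight : Subset n → List (Fin n) → ℚ
  redWeight B vs = redSum vs (restrict B w)

  redRevenue : Subset n → List (Fin n) → Tree n → ℚ
  redRevenue B vs T = redSum vs (restrict B (revenue T))

  degIn-nonneg : ∀ B v → 0ℚ ≤ degIn B v
  degIn-nonneg B v = Σ-nonneg λ u → []·-nonneg (u ∈ᵇ B) (w-nonneg v u)

  degIn-remove-≤ : ∀ B v u → degIn (remove B v) u ≤ degIn B u
  degIn-remove-≤ B v u = Σ-mono-≤ λ x → guard-≤ (x ∈? remove B v) (x ∈? B) (w-nonneg u x)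
    where
    guard-≤ : ∀ {x} (p? : Dec (x ∈ remove B v)) (q? : Dec (x ∈ B)) {y} → 0ℚ ≤ y →
              [ does p? ]· y ≤ [ does q? ]· y
    guard-≤ (yes _)  (yes _)  _   = ℚ.≤-refl
    guard-≤ (yes p)  (no ¬q)  _   = ⊥-elim (¬q (proj₂ (∈-remove⁻ p)))
    guard-≤ (no _)   (yes _)  0≤y = 0≤y
    guard-≤ (no _)   (no _)   _   = ℚ.≤-refl

  redWeight-singleton : ∀ {B v} → v ∈ B → redWeight B (v ∷ []) ≡ degIn B v
  redWeight-singleton {B} {v} v∈B = trans
    (redSum-singleton v (restrict B w) (restrict-sym B w-sym) (restrict-diag B {w} v (w-loop v)))
    (cong (λ b → Σ λ u → [ b ∧ u ∈ᵇ B ]· w v u) (dec-true (v ∈? B) v∈B))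

  redWeight-∷ : ∀ {B v} vs → v ∈ B → redWeight B (v ∷ vs) ≡ degIn B v + redWeight (remove B v) vs
  redWeight-∷ {B} {v} vs v∈B =
    trans (redSum-∷ B v vs w) (cong (_+ redWeight (remove B v) vs) (redWeight-singleton v∈B))

  redRevenue-singleton : ∀ {B v} T → v ∈ B → LcaAtRoot T v →
                         redRevenue B (v ∷ []) T ≡ ℕ→ℚ (nLeaves T) * degIn B v
  redRevenue-singleton {B} {v} T v∈B atRoot = begin
    redRevenue B (v ∷ []) T
      ≡⟨ Σpairs-cong (λ i j i<j → at-root i j i<j (v ≟ i) (v ≟ j)) ⟩
    redSum (v ∷ []) (λ i j → N * restrict B w i j)
      ≡⟨ redSum-*ˡ (v ∷ []) N (restrict B w) ⟩
    N * redWeight B (v ∷ [])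
      ≡⟨ cong (N *_) (redWeight-singleton v∈B) ⟩
    N * degIn B v ∎
    where
    open ≡-Reasoning
    N = ℕ→ℚ (nLeaves T)
    root-pair : ∀ i j → i F.< j → v ≡ i ⊎ v ≡ j → restrict B (revenue T) i j ≡ N * restrict B w i j
    root-pair i j i<j v∈ij = begin
      [ inB ]· (w i j * ℕ→ℚ (lcaSize T i j))
        ≡⟨ cong (λ m → [ inB ]· (w i j * ℕ→ℚ m)) (atRoot i j (<⇒≢ i<j) v∈ij) ⟩
      [ inB ]· (w i j * N)
        ≡⟨ cong [ inB ]·_ (ℚ.*-comm (w i j) N) ⟩
      [ inB ]· (N * w i j)
        ≡⟨ []·-*ˡ inB N (w i j) ⟩
      N * restrict B w i j ∎
      where inB = i ∈ᵇ B ∧ j ∈ᵇ B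
    at-root : ∀ i j → i F.< j → (v≟i : Dec (v ≡ i)) (v≟j : Dec (v ≡ j)) →
              [ (does v≟i ∨ false) ∨ (does v≟j ∨ false) ]· restrict B (revenue T) i j
              ≡ [ (does v≟i ∨ false) ∨ (does v≟j ∨ false) ]· (N * restrict B w i j)
    at-root i j i<j (yes refl) (yes refl) = ⊥-elim (<-irrefl refl i<j)
    at-root i j i<j (yes refl) (no _)     = root-pair i j i<j (inj₁ refl)
    at-root i j i<j (no _)     (yes refl) = root-pair i j i<j (inj₂ refl)
    at-root i j i<j (no _)     (no _)     = refl

  redRevenue-∷ : ∀ {B v} vs T → v ∈ B → LcaAtRoot T v →
                 redRevenue B (v ∷ vs) T ≡ ℕ→ℚ (nLeaves T) * degIn B v + redRevenue (remove B v) vs T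
  redRevenue-∷ {B} {v} vs T v∈B atRoot = trans (redSum-∷ B v vs (revenue T))
    (cong (_+ redRevenue (remove B v) vs T) (redRevenue-singleton T v∈B atRoot))

  redWeight-≤ : ∀ {B vs B′} → Peel G thr B vs B′ → ∀ {D} → (∀ {u} → u ∈ B → degIn B u ≤ D) →
                redWeight B vs ≤ ℕ→ℚ (length vs) * D
  redWeight-≤ {B} (stop _) {D} _ = ℚ.≤-reflexive (trans (redSum-[] (restrict B w)) (sym (ℚ.*-zeroˡ D)))
  redWeight-≤ {B} (step {vs = vs} v v∈B _ _ peel) {D} deg≤D = begin
    redWeight B (v ∷ vs)                    ≡⟨ redWeight-∷ vs v∈B ⟩
    degIn B v + redWeight (remove B v) vs   ≤⟨ ℚ.+-mono-≤ (deg≤D v∈B) (redWeight-≤ peel deg′≤D) ⟩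
    D + ℕ→ℚ (length vs) * D                 ≡⟨ sym (ℕ→ℚ-suc-* (length vs) D) ⟩
    ℕ→ℚ (ℕ.suc (length vs)) * D             ∎
    where
    open ℚ.≤-Reasoning
    deg′≤D : ∀ {u} → u ∈ remove B v → degIn (remove B v) u ≤ D
    deg′≤D u∈B-v = ℚ.≤-trans (degIn-remove-≤ B v _) (deg≤D (proj₂ (∈-remove⁻ u∈B-v)))

  nothing-peeled : ∀ c B T → c * redWeight B [] ≤ redRevenue B [] T
  nothing-peeled c B T = ℚ.≤-reflexive (begin
    c * redWeight B []   ≡⟨ cong (c *_) (redSum-[] (restrict B w)) ⟩
    c * 0ℚ               ≡⟨ ℚ.*-zeroʳ c ⟩
    0ℚ                   ≡⟨ sym (redSum-[] (restrict B (revenue T))) ⟩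
    redRevenue B [] T    ∎)
    where open ≡-Reasoning

  peel-step : ∀ {B v vs B′ T N′} → v ∈ B → (∀ u → u ∈ B → degIn B u ≤ degIn B v) →
              Peel G thr (remove B v) vs B′ → nLeaves T ≡ ℕ.suc N′ → LcaAtRoot T v →
              (ℕ→ℚ N′ - ℕ→ℚ (length vs) * ½) * redWeight (remove B v) vs
                ≤ redRevenue (remove B v) vs T →
              (ℕ→ℚ (ℕ.suc N′) - ℕ→ℚ (ℕ.suc (length vs)) * ½) * redWeight B (v ∷ vs)
                ≤ redRevenue B (v ∷ vs) T
  peel-step {B} {v} {vs} {T = T} {N′} v∈B maximal peel |T|≡1+N′ atRoot ih = begin
    (ℕ→ℚ (ℕ.suc N′) - ℕ→ℚ (ℕ.suc K) * ½) * redWeight B (v ∷ vs)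
      ≡⟨ cong₂ (λ x y → (x - y * ½) * redWeight B (v ∷ vs)) (ℕ→ℚ-suc N′) (ℕ→ℚ-suc K) ⟩
    ((1ℚ + ℕ→ℚ N′) - (1ℚ + ℕ→ℚ K) * ½) * redWeight B (v ∷ vs)
      ≡⟨ cong (((1ℚ + ℕ→ℚ N′) - (1ℚ + ℕ→ℚ K) * ½) *_) (redWeight-∷ vs v∈B) ⟩
    ((1ℚ + ℕ→ℚ N′) - (1ℚ + ℕ→ℚ K) * ½) * (degIn B v + redWeight (remove B v) vs)
      ≤⟨ averaging-step (ℕ→ℚ N′) (ℕ→ℚ K) (degIn-nonneg B v) later-light ih ⟩
    (1ℚ + ℕ→ℚ N′) * degIn B v + redRevenue (remove B v) vs T
      ≡⟨ cong (λ x → x * degIn B v + redRevenue (remove B v) vs T) (sym |T|) ⟩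
    ℕ→ℚ (nLeaves T) * degIn B v + redRevenue (remove B v) vs T
      ≡⟨ sym (redRevenue-∷ vs T v∈B atRoot) ⟩
    redRevenue B (v ∷ vs) T ∎
    where
    open ℚ.≤-Reasoning
    K = length vs
    |T| : ℕ→ℚ (nLeaves T) ≡ 1ℚ + ℕ→ℚ N′
    |T| = trans (cong ℕ→ℚ |T|≡1+N′) (ℕ→ℚ-suc N′)
    later-light : redWeight (remove B v) vs ≤ ℕ→ℚ K * degIn B v
    later-light = redWeight-≤ peel λ u∈B-v →
      ℚ.≤-trans (degIn-remove-≤ B v _) (maximal _ (proj₂ (∈-remove⁻ u∈B-v)))

  redRevenue-≥ : ∀ {B vs B′ TB T} → Peel G thr B vs B′ → caterpillar vs TB ≡ just T →
                 Unique (leaves T) → (∀ {i} → i ∈ B → i ∈ₗ leaves T) →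
                 (ℕ→ℚ (nLeaves T) - ℕ→ℚ (length vs) * ½) * redWeight B vs ≤ redRevenue B vs T
  redRevenue-≥ {B} {T = T} (stop _) _ _ _ = nothing-peeled (ℕ→ℚ (nLeaves T) - ℕ→ℚ 0 * ½) B T
  redRevenue-≥ {B} (step {vs = vs} v v∈B _ maximal peel) cat uniq covers with caterpillar-∷ v vs _ cat
  ... | inj₁ (refl , refl) = peel-step {T = leaf v} {N′ = 0} v∈B maximal peel refl (λ _ _ _ _ → refl)
    (nothing-peeled (ℕ→ℚ 0 - ℕ→ℚ 0 * ½) (remove B v) (leaf v))
  ... | inj₂ (T′ , cat′ , refl) = peel-step {T = node (leaf v) T′} {N′ = nLeaves T′} v∈B maximal peel refl
    (lcaAtRoot-spine v T′ v∉T′) (ℚ.≤-trans ih (ℚ.≤-reflexive (sym below)))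
    where
    v∉T′ = AllPairs.head uniq
    covers′ : ∀ {i} → i ∈ remove B v → i ∈ₗ leaves T′
    covers′ i∈B-v with ∈-remove⁻ i∈B-v
    ... | v≢i , i∈B with covers i∈B
    ...   | here i≡v  = ⊥-elim (v≢i (sym i≡v))
    ...   | there i∈T′ = i∈T′
    ih = redRevenue-≥ peel cat′ (AllPairs.tail uniq) covers′
    below : redRevenue (remove B v) vs (node (leaf v) T′) ≡ redRevenue (remove B v) vs T′
    below = redSum-cong vs (restrict-cong (remove B v) λ i∈ j∈ → cong (λ m → w _ _ * ℕ→ℚ m)
      (lcaSize-spine-below v T′ (proj₁ (∈-remove⁻ i∈)) (covers′ i∈) (covers′ j∈)))

-- The bound holds for every peeling threshold.
lemma2 : (n : ℕ) .{{_ : NonZero n}} (G : WGraph n) (γ Rstar : ℚ) →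
         1ℚ ≤ γ → 0ℚ < Rstar → Rstar < + 1 / 2 →
         (vs : List (Fin n)) (VB : Subset n) →
         Peel G (γ * ((+ 2 / 1) * WGraph.totalW G * (+ 1 / n))) ⊤ vs VB →
         (TB : Maybe (Tree n)) (T : Tree n) →
         caterpillar vs TB ≡ just T → IsHC T →
         ALG-P G vs T ≥ (1ℚ - (+ length vs / n) * (+ 1 / 2)) * ℕ→ℚ n * W-R G vs
lemma2 n@(ℕ.suc n′) G γ _ _ _ _ vs _ peel _ T cat (uniq , covers) = begin
  (1ℚ - (+ k / n) * ½) * ℕ→ℚ n * W-R G vs
    ≡⟨ cong (_* W-R G vs) coefficient ⟩
  (ℕ→ℚ n - ℕ→ℚ k * ½) * W-R G vs
    ≤⟨ ℚ.*-monoʳ-≤-nonNeg (W-R G vs) {{nonNegative 0≤W-R}} (ℚ.+-monoˡ-≤ (- (ℕ→ℚ k * ½)) n≤N) ⟩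
  (N - ℕ→ℚ k * ½) * W-R G vs
    ≡⟨ cong ((N - ℕ→ℚ k * ½) *_) (redSum-cong vs (sym ∘₂ restrict-⊤ w)) ⟩
  (N - ℕ→ℚ k * ½) * redWeight ⊤ vs
    ≤⟨ redRevenue-≥ peel cat uniq (λ {i} _ → covers i) ⟩
  redRevenue ⊤ vs T
    ≡⟨ redSum-cong vs (restrict-⊤ (revenue T)) ⟩
  ALG-P G vs T ∎
  where
  open WGraph G
  open Peeling G _
  open ℚ.≤-Reasoning
  k = length vs
  N = ℕ→ℚ (nLeaves T)
  coefficient : (1ℚ - (+ k / n) * ½) * ℕ→ℚ n ≡ ℕ→ℚ n - ℕ→ℚ k * ½
  coefficient = trans
    (solve 2 (λ q m → (con 1ℚ :- q :* con ½) :* m := m :- (q :* m) :* con ½) refl (+ k / n) (ℕ→ℚ n))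
    (cong (λ x → ℕ→ℚ n - x * ½) (k/n*n≡k k n′))
    where open +-*-Solver
  n≤N : ℕ→ℚ n ≤ N
  n≤N = ℕ→ℚ-mono-≤ (n≤nLeaves T covers)
  0≤W-R : 0ℚ ≤ W-R G vs
  0≤W-R = redSum-nonneg vs w-nonneg
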